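{- Let $n \geq 3$ and let $P_n$ be the path on $n$ vertices. Then $\mathcal{D}_{\mathrm{lir}}(P_n) = 0$ if $n$ is odd, and $\mathcal{D}_{\mathrm{lir}}(P_n) = 1$ if $n$ is even.
   Context: A (multi)graph is locally irregular if the two endvertices of every edge have different degrees (degrees in multigraphs count parallel edges with multiplicity). For a graph $G$ and a set $E_d \subseteq E(G)$, $G + E_d$ denotes the multigraph obtained from $G$ by replacing each edge of $E_d$ by two parallel edges. For a connected graph $G$ not isomorphic to $K_2$ or $K_3$, $\mathcal{D}_{\mathrm{lir}}(G)$ is the minimum size of a set $E_d \subseteq E(G)$ such that the edges of $G+E_d$ can be colored with at most two colors so that each color class induces a locally irregular sub(multi)graph and any two parallel edges receive the same color. -}

module Defs where

open import Data.Nat using (ℕ; zero; suc; _+_; _≤_)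
open import Data.Fin using (Fin; inject₁; _≟_)
import Data.Fin as F
open import Data.Bool using (Bool; true; false; if_then_else_)
open import Data.List using (List; map; allFin)
open import Data.Nat.ListAction using (sum)
open import Data.Product using (_×_; _,_; proj₁; proj₂; Σ; ∃)
open import Relation.Binary.PropositionalEquality using (_≡_; _≢_)
open import Relation.Nullary using (does)

record Graph : Set where
  field
    V    : ℕ
    m    : ℕ
    edge : Fin m → Fin V × Fin V
open Graph public

pathGraph : ℕ → Graph
pathGraph zero    = record { V = zero ; m = zero ; edge = λ () }
pathGraph (suc k) = record { V = suc k ; m = k ; edge = λ i → (inject₁ i , F.suc i) }

EdgeSet : Graph → Set
EdgeSet G = Fin (m G) → Bool

size : (G : Graph) → EdgeSet G → ℕ
size G d = sum (map (λ e → if d e then 1 else 0) (allFin (m G)))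

-- A 2-edge-colouring of G + E_d.  Parallel copies of an edge must receive the
-- same colour, so a colouring is a colour per edge of G.
Colouring : Graph → Set
Colouring G = Fin (m G) → Bool

mult : (G : Graph) → EdgeSet G → Fin (m G) → ℕ
mult G d e = if d e then 2 else 1

incident : (G : Graph) → Fin (V G) → Fin (m G) → Bool
incident G v e =
  if does (v ≟ proj₁ (edge G e)) then true else does (v ≟ proj₂ (edge G e))

degIn : (G : Graph) → EdgeSet G → Colouring G → Bool → Fin (V G) → ℕ
degIn G d col c v =
  sum (map (λ e → if does (Data.Bool._≟_ (col e) c)
                   then (if incident G v e then mult G d e else 0)
                   else 0)
           (allFin (m G)))
  where import Data.Bool

ClassLocallyIrregular : (G : Graph) → EdgeSet G → Colouring G → Bool → Set
ClassLocallyIrregular G d col c =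
  ∀ e → col e ≡ c →
    degIn G d col c (proj₁ (edge G e)) ≢ degIn G d col c (proj₂ (edge G e))

LocIrr2Colouring : (G : Graph) → EdgeSet G → Colouring G → Set
LocIrr2Colouring G d col = ∀ c → ClassLocallyIrregular G d col c

Admissible : (G : Graph) → EdgeSet G → Set
Admissible G d = Σ (Colouring G) (LocIrr2Colouring G d)

DlirIs : Graph → ℕ → Set
DlirIs G k =
  (Σ (EdgeSet G) λ d → Admissible G d × size G d ≡ k) ×
  (∀ (d : EdgeSet G) → Admissible G d → k ≤ size G d)

-- An edge i of a path whose colour class gives the edges weights w (multiplicity inside the
-- class, 0 outside) joins vertices of degrees w(i−1) + w(i) and w(i) + w(i+1), so it is
-- irregular exactly when w(i−1) ≠ w(i+1). Without doubled edges all weights are 0 or 1, and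
-- this forces every maximal monochromatic run of edges to have length two: the number n − 1
-- of edges is even. Conversely, colouring consecutive pairs of edges alternately works when
-- n is odd; when n is even, a leading monochromatic P₄ with its first edge doubled has the
-- irregular degrees 2, 3, 2, 1 and absorbs the extra edge.
module Submission where

open import Defs
open import Data.Bool using (Bool; true; false; not; if_then_else_)
import Data.Bool as B
open import Data.Bool.Properties using (not-¬)
open import Data.Fin using (Fin; toℕ; fromℕ<; inject₁)
import Data.Fin as F
open import Data.Fin.Properties using (toℕ<n; toℕ-inject₁; toℕ-fromℕ<)
open import Data.List using (List; []; _∷_; map; allFin)
open import Data.List.Properties using (map-cong; map-tabulate)
open import Data.List.Membership.Propositional using (_∈_)
open import Data.List.Membership.Propositional.Properties using (∈-allFin)
open import Data.List.Relation.Unary.Any using (here; there)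
open import Data.Nat using (ℕ; zero; suc; _+_; _*_; _≤_; _<_; z≤n; s≤s; s<s⁻¹; _%_; _/_)
open import Data.Nat.DivMod using (m≡m%n+[m/n]*n)
open import Data.Nat.ListAction using (sum)
open import Data.Nat.Properties
  using (_<?_; +-comm; +-cancelˡ-≡; m+n≡0⇒m≡0; m+n≡0⇒n≡0; ≤⇒≯; ≮⇒≥; <-irrefl; <-trans; n<1+n;
         n≢0⇒n>0; 0≢1+n)
open import Data.Product using (_×_; _,_; proj₁; proj₂)
open import Function using (_∘_; id)
open import Relation.Binary.PropositionalEquality
open import Relation.Nullary using (¬_; does)
open import Relation.Nullary.Decidable using (dec-true; dec-false; decidable-stable)

sum-allFin-suc : ∀ {k} (f : Fin (suc k) → ℕ) →
  sum (map f (allFin (suc k))) ≡ f F.zero + sum (map (f ∘ F.suc) (allFin k))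
sum-allFin-suc f =
  cong (λ xs → f F.zero + sum xs)
       (trans (map-tabulate F.suc f) (sym (map-tabulate id (f ∘ F.suc))))

sum-map-≡0 : {A : Set} (f : A → ℕ) (xs : List A) → (∀ x → f x ≡ 0) → sum (map f xs) ≡ 0
sum-map-≡0 f []       f≡0 = refl
sum-map-≡0 f (x ∷ xs) f≡0 = cong₂ _+_ (f≡0 x) (sum-map-≡0 f xs f≡0)

sum-map-≡0⁻ : {A : Set} (f : A → ℕ) {xs : List A} {x : A} →
  sum (map f xs) ≡ 0 → x ∈ xs → f x ≡ 0
sum-map-≡0⁻ f {y ∷ _} s≡0 (here refl) = m+n≡0⇒m≡0 (f y) s≡0
sum-map-≡0⁻ f {y ∷ _} s≡0 (there x∈) = sum-map-≡0⁻ f (m+n≡0⇒n≡0 (f y) s≡0) x∈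

size-empty : ∀ G → size G (λ _ → false) ≡ 0
size-empty G = sum-map-≡0 _ (allFin (m G)) (λ _ → refl)

size≡0⇒empty : ∀ G (d : EdgeSet G) → size G d ≡ 0 → ∀ e → d e ≡ false
size≡0⇒empty G d size≡0 e = indicator≡0 (d e) (sum-map-≡0⁻ _ size≡0 (∈-allFin e))
  where
  indicator≡0 : ∀ b → (if b then 1 else 0) ≡ 0 → b ≡ false
  indicator≡0 false _ = refl

extend : ∀ {k} → (Fin k → Bool) → ℕ → Bool
extend {zero}  f _       = false
extend {suc k} f zero    = f F.zero
extend {suc k} f (suc j) = extend (f ∘ F.suc) j

extend-toℕ : ∀ {k} (f : Fin k → Bool) e → f e ≡ extend f (toℕ e)
extend-toℕ f F.zero    = refl
extend-toℕ f (F.suc e) = extend-toℕ (f ∘ F.suc) e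

left : (ℕ → ℕ) → ℕ → ℕ
left w zero    = 0
left w (suc i) = w i

incidentWeight : ∀ k → (ℕ → ℕ) → Fin (suc k) → Fin k → ℕ
incidentWeight k W v e = if incident (pathGraph (suc k)) v e then W (toℕ e) else 0

incidenceSum-path : ∀ k (W : ℕ → ℕ) → (∀ j → k ≤ j → W j ≡ 0) → ∀ v →
  sum (map (incidentWeight k W v) (allFin k)) ≡ W (toℕ v) + left W (toℕ v)
incidenceSum-path zero W W≡0 F.zero = cong (_+ 0) (sym (W≡0 0 z≤n))
incidenceSum-path (suc k) W W≡0 F.zero =
  trans (sum-allFin-suc (incidentWeight (suc k) W F.zero))
        (cong (W 0 +_) (sum-map-≡0 _ (allFin k) (λ _ → refl)))
incidenceSum-path (suc k) W W≡0 (F.suc F.zero) = begin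
  sum (map (incidentWeight (suc k) W (F.suc F.zero)) (allFin (suc k)))
    ≡⟨ sum-allFin-suc (incidentWeight (suc k) W (F.suc F.zero)) ⟩
  W 0 + sum (map (incidentWeight k (W ∘ suc) F.zero) (allFin k))
    ≡⟨ cong (W 0 +_) (incidenceSum-path k (W ∘ suc) (λ j → W≡0 (suc j) ∘ s≤s) F.zero) ⟩
  W 0 + (W 1 + 0)
    ≡⟨ cong (W 0 +_) (+-comm (W 1) 0) ⟩
  W 0 + W 1
    ≡⟨ +-comm (W 0) (W 1) ⟩
  W 1 + W 0
    ∎
  where open ≡-Reasoning
incidenceSum-path (suc k) W W≡0 (F.suc (F.suc v)) =
  trans (sum-allFin-suc (incidentWeight (suc k) W (F.suc (F.suc v))))
        (incidenceSum-path k (W ∘ suc) (λ j → W≡0 (suc j) ∘ s≤s) (F.suc v))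

-- A colouring C and doubling D of the path with k edges, read as sequences indexed by ℕ;
-- edges j ≥ k get weight 0.
weight : ℕ → (C D : ℕ → Bool) → Bool → ℕ → ℕ
weight k C D c j =
  if does (j <? k) then (if does (C j B.≟ c) then (if D j then 2 else 1) else 0) else 0

module _ (k : ℕ) (C D : ℕ → Bool) (c : Bool) where

  weight-inRange : ∀ {j} → j < k →
    weight k C D c j ≡ (if does (C j B.≟ c) then (if D j then 2 else 1) else 0)
  weight-inRange {j} j<k rewrite dec-true (j <? k) j<k = refl

  weight-beyond : ∀ {j} → k ≤ j → weight k C D c j ≡ 0
  weight-beyond {j} k≤j rewrite dec-false (j <? k) (≤⇒≯ k≤j) = refl

  weight-same : ∀ {j} → j < k → C j ≡ c → weight k C D c j ≡ (if D j then 2 else 1)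
  weight-same {j} j<k Cj≡c rewrite weight-inRange j<k | dec-true (C j B.≟ c) Cj≡c = refl

  weight-other : ∀ {j} → C j ≢ c → weight k C D c j ≡ 0
  weight-other {j} Cj≢c with does (j <? k)
  ... | false = refl
  ... | true rewrite dec-false (C j B.≟ c) Cj≢c = refl

  weight≢0 : ∀ {j} → weight k C D c j ≢ 0 → j < k × C j ≡ c
  weight≢0 {j} w≢0 =
    decidable-stable (j <? k) (w≢0 ∘ weight-beyond ∘ ≮⇒≥) ,
    decidable-stable (C j B.≟ c) (w≢0 ∘ weight-other)

-- Edge i joins vertices of class degrees left w i + w i and w i + w (suc i); cancelling w i
-- leaves the condition below.
IrregularEdge : ℕ → (C D : ℕ → Bool) → ℕ → Set
IrregularEdge k C D i = left (weight k C D (C i)) i ≢ weight k C D (C i) (suc i)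

IrregularPath : ℕ → (C D : ℕ → Bool) → Set
IrregularPath k C D = ∀ i → i < k → IrregularEdge k C D i

module _ {k : ℕ} {d col : Fin k → Bool} (C D : ℕ → Bool)
         (col≗C : ∀ e → col e ≡ C (toℕ e)) (d≗D : ∀ e → d e ≡ D (toℕ e)) where

  private
    G : Graph
    G = pathGraph (suc k)

  degIn-path : ∀ c v →
    degIn G d col c v ≡ weight k C D c (toℕ v) + left (weight k C D c) (toℕ v)
  degIn-path c v =
    trans (cong sum (map-cong classWeight (allFin k)))
          (incidenceSum-path k (weight k C D c) (λ _ → weight-beyond k C D c) v)
    where
    classWeight : ∀ e →
      (if does (col e B.≟ c) then (if incident G v e then mult G d e else 0) else 0)
        ≡ incidentWeight k (weight k C D c) v e
    classWeight e rewrite weight-inRange k C D c (toℕ<n e) | col≗C e | d≗D e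
      with incident G v e | does (C (toℕ e) B.≟ c)
    ... | false | false = refl
    ... | false | true  = refl
    ... | true  | false = refl
    ... | true  | true  = refl

  module _ (c : Bool) (e : Fin k) where
    private
      W : ℕ → ℕ
      W = weight k C D c
      i : ℕ
      i = toℕ e

    degIn-inject₁ : degIn G d col c (inject₁ e) ≡ W i + left W i
    degIn-inject₁ =
      trans (degIn-path c (inject₁ e)) (cong (λ j → W j + left W j) (toℕ-inject₁ e))

    degIn-suc : degIn G d col c (F.suc e) ≡ W i + W (suc i)
    degIn-suc = trans (degIn-path c (F.suc e)) (+-comm (W (suc i)) (W i))

    endDegrees-≡⇒ : degIn G d col c (inject₁ e) ≡ degIn G d col c (F.suc e) → left W i ≡ W (suc i)
    endDegrees-≡⇒ eq = +-cancelˡ-≡ (W i) _ _ (trans (sym degIn-inject₁) (trans eq degIn-suc))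

    endDegrees-≡⇐ : left W i ≡ W (suc i) → degIn G d col c (inject₁ e) ≡ degIn G d col c (F.suc e)
    endDegrees-≡⇐ eq = trans degIn-inject₁ (trans (cong (W i +_) eq) (sym degIn-suc))

  irregularPath⇒locIrr : IrregularPath k C D → LocIrr2Colouring G d col
  irregularPath⇒locIrr irr c e col-e≡c =
    irr (toℕ e) (toℕ<n e)
    ∘ subst (λ c′ → left (weight k C D c′) (toℕ e) ≡ weight k C D c′ (suc (toℕ e)))
            (trans (sym col-e≡c) (col≗C e))
    ∘ endDegrees-≡⇒ c e

  locIrr⇒irregularPath : LocIrr2Colouring G d col → IrregularPath k C D
  locIrr⇒irregularPath locIrr i i<k =
    subst (IrregularEdge k C D) (toℕ-fromℕ< i<k) (irregularAt (fromℕ< i<k))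
    where
    irregularAt : ∀ e → IrregularEdge k C D (toℕ e)
    irregularAt e = locIrr (C (toℕ e)) e (col≗C e) ∘ endDegrees-≡⇐ (C (toℕ e)) e

noDoubling : ℕ → Bool
noDoubling _ = false

StartsRun : ℕ → (ℕ → Bool) → ℕ → Set
StartsRun k C i = left (weight k C noDoubling (C i)) i ≡ 0

module _ {k : ℕ} {C : ℕ → Bool} (irr : IrregularPath k C noDoubling) where

  private
    w : Bool → ℕ → ℕ
    w = weight k C noDoubling

  run-of-two : ∀ {i} → i < k → StartsRun k C i →
    suc i < k × C (suc i) ≡ C i × (suc (suc i) < k → StartsRun k C (suc (suc i)))
  run-of-two {i} i<k start = si<k , same , nextStarts
    where
    c : Bool
    c = C i
    si<k×same : suc i < k × C (suc i) ≡ c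
    si<k×same = weight≢0 k C noDoubling c (irr i i<k ∘ trans start ∘ sym)
    si<k : suc i < k
    si<k = proj₁ si<k×same
    same : C (suc i) ≡ c
    same = proj₂ si<k×same

    w-ssi≢1 : w c (suc (suc i)) ≢ 1
    w-ssi≢1 eq = irr (suc i) si<k
      (subst (λ c′ → w c′ i ≡ w c′ (suc (suc i))) (sym same)
             (trans (weight-same k C noDoubling c i<k refl) (sym eq)))

    nextStarts : suc (suc i) < k → StartsRun k C (suc (suc i))
    nextStarts ssi<k = weight-other k C noDoubling _
      (λ eq → w-ssi≢1 (weight-same k C noDoubling c ssi<k (trans (sym eq) same)))

  startsRun-even : ∀ j → j * 2 < k → StartsRun k C (j * 2)
  startsRun-even zero    _    = refl
  startsRun-even (suc j) sj<k = proj₂ (proj₂ (run-of-two j<k (startsRun-even j j<k))) sj<k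
    where
    j<k : j * 2 < k
    j<k = <-trans (n<1+n _) (<-trans (n<1+n _) sj<k)

oddEdgeCount⇒¬irregular : ∀ h C → ¬ IrregularPath (suc (h * 2)) C noDoubling
oddEdgeCount⇒¬irregular h C irr =
  <-irrefl refl
    (proj₁ (run-of-two {C = C} irr (n<1+n _) (startsRun-even {C = C} irr h (n<1+n _))))

pairColour : ℕ → Bool
pairColour zero          = false
pairColour (suc zero)    = false
pairColour (suc (suc j)) = not (pairColour j)

pairColour-pair : ∀ j → pairColour (suc (j * 2)) ≡ pairColour (j * 2)
pairColour-pair zero    = refl
pairColour-pair (suc j) = cong not (pairColour-pair j)

data Parity : ℕ → Set where
  even : ∀ j → Parity (j * 2)
  odd  : ∀ j → Parity (suc (j * 2))

parity : ∀ i → Parity i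
parity zero = even 0
parity (suc i) with parity i
... | even j = odd j
... | odd j  = even (suc j)

m*2<n*2⇒1+m*2<n*2 : ∀ m n → m * 2 < n * 2 → suc (m * 2) < n * 2
m*2<n*2⇒1+m*2<n*2 zero    (suc n) _                 = s≤s (s≤s z≤n)
m*2<n*2⇒1+m*2<n*2 (suc m) (suc n) (s≤s (s≤s m<n)) = s≤s (s≤s (m*2<n*2⇒1+m*2<n*2 m n m<n))

pairColour-startsRun : ∀ h j → StartsRun (h * 2) pairColour (j * 2)
pairColour-startsRun h zero    = refl
pairColour-startsRun h (suc j) =
  weight-other (h * 2) pairColour noDoubling _ (not-¬ (pairColour-pair j))

pairs-irregular : ∀ h → IrregularPath (h * 2) pairColour noDoubling
pairs-irregular h i i<k with parity i
... | even j =
  subst₂ _≢_ (sym (pairColour-startsRun h j))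
             (sym (weight-same (h * 2) pairColour noDoubling _ (m*2<n*2⇒1+m*2<n*2 j h i<k)
                               (pairColour-pair j)))
             0≢1+n
... | odd j =
  subst₂ _≢_ (sym (weight-same (h * 2) pairColour noDoubling _ (<-trans (n<1+n _) i<k)
                               (sym (pairColour-pair j))))
             (sym (weight-other (h * 2) pairColour noDoubling _ (≢-sym (not-¬ (pairColour-pair j)))))
             (0≢1+n ∘ sym)

headThenPairs : ℕ → Bool
headThenPairs zero                = true
headThenPairs (suc zero)          = true
headThenPairs (suc (suc zero))    = true
headThenPairs (suc (suc (suc j))) = pairColour j

firstDoubled : ℕ → Bool
firstDoubled zero    = true
firstDoubled (suc _) = false

-- From edge 3 on this is the pair colouring shifted by three; edge 2 (colour true) is not in
-- the class of edge 3 (colour false).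
headThenPairs-irregular : ∀ h → IrregularPath (3 + h * 2) headThenPairs firstDoubled
headThenPairs-irregular h 0 _ = λ ()
headThenPairs-irregular h 1 _ = λ ()
headThenPairs-irregular h 2 _ =
  subst (1 ≢_) (sym (weight-other (3 + h * 2) headThenPairs firstDoubled true {3} λ ())) λ ()
headThenPairs-irregular h 3 i<k = pairs-irregular h 0 (s<s⁻¹ (s<s⁻¹ (s<s⁻¹ i<k)))
headThenPairs-irregular h (suc (suc (suc (suc j)))) i<k =
  pairs-irregular h (suc j) (s<s⁻¹ (s<s⁻¹ (s<s⁻¹ i<k)))

size-firstDoubled : ∀ k → size (pathGraph (suc (suc k))) (firstDoubled ∘ toℕ) ≡ 1
size-firstDoubled k =
  trans (sum-allFin-suc {k} (λ e → if firstDoubled (toℕ e) then 1 else 0))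
        (cong suc (sum-map-≡0 (λ e → if firstDoubled (toℕ (F.suc e)) then 1 else 0)
                              (allFin k) (λ _ → refl)))

Dlir-oddPath : ∀ h → DlirIs (pathGraph (suc (h * 2))) 0
Dlir-oddPath h =
  ((λ _ → false) ,
   (pairColour ∘ toℕ ,
    irregularPath⇒locIrr pairColour noDoubling (λ _ → refl) (λ _ → refl) (pairs-irregular h)) ,
   size-empty (pathGraph (suc (h * 2)))) ,
  λ _ _ → z≤n

Dlir-evenPath : ∀ q → 3 ≤ q * 2 → DlirIs (pathGraph (q * 2)) 1
Dlir-evenPath (suc zero) (s≤s (s≤s ()))
Dlir-evenPath (suc (suc h)) _ =
  (firstDoubled ∘ toℕ ,
   (headThenPairs ∘ toℕ ,
    irregularPath⇒locIrr headThenPairs firstDoubled (λ _ → refl) (λ _ → refl)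
                         (headThenPairs-irregular h)) ,
   size-firstDoubled (suc (suc (h * 2)))) ,
  needsDoubling
  where
  P : Graph
  P = pathGraph (suc (suc h) * 2)

  needsDoubling : ∀ d → Admissible P d → 1 ≤ size P d
  needsDoubling d (col , locIrr) = n≢0⇒n>0 λ size≡0 →
    oddEdgeCount⇒¬irregular (suc h) (extend col)
      (locIrr⇒irregularPath (extend col) noDoubling (extend-toℕ col) (size≡0⇒empty P d size≡0)
                            locIrr)

mainTheorem1 : (n : ℕ) → 3 ≤ n →
    (n % 2 ≡ 1 → DlirIs (pathGraph n) 0) × (n % 2 ≡ 0 → DlirIs (pathGraph n) 1)
mainTheorem1 n 3≤n = oddCase , evenCase
  where
  n≡ : ∀ {r} → n % 2 ≡ r → n ≡ r + n / 2 * 2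
  n≡ n%2≡r = trans (m≡m%n+[m/n]*n n 2) (cong (_+ n / 2 * 2) n%2≡r)

  oddCase : n % 2 ≡ 1 → DlirIs (pathGraph n) 0
  oddCase n%2≡1 =
    subst (λ n′ → DlirIs (pathGraph n′) 0) (sym (n≡ n%2≡1)) (Dlir-oddPath (n / 2))

  evenCase : n % 2 ≡ 0 → DlirIs (pathGraph n) 1
  evenCase n%2≡0 = subst (λ n′ → DlirIs (pathGraph n′) 1) (sym (n≡ n%2≡0))
                          (Dlir-evenPath (n / 2) (subst (3 ≤_) (n≡ n%2≡0) 3≤n))
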